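{- Let $p_1\neq p_2$ be primes. Suppose $G,H_1,H_2\in K_1$ with $G\leq_{\mathbf{K}_1}H_1$ and $G\leq_{\mathbf{K}_1}H_2$, $a_1\in H_1$, $a_2\in H_2$, and $p_2^\omega H_1\subseteq G$, $p_2^\omega H_2\subseteq G$. Then $\mathbf{gtp}_{\mathbf{K}_{TF}}(a_1/G;H_1)=\mathbf{gtp}_{\mathbf{K}_{TF}}(a_2/G;H_2)$ if and only if $\mathbf{gtp}_{\mathbf{K}_1}(a_1/G;H_1)=\mathbf{gtp}_{\mathbf{K}_1}(a_2/G;H_2)$.
   Context: For a prime $p$ and group $G$, $p^\omega G:=\bigcap_{n<\omega}p^nG$; $\leq_p$ denotes pure subgroup. $\mathbf{K}_{TF}=(TF,\leq_p)$ is the class of torsion-free abelian groups with the pure subgroup relation. $\mathbf{K}_1=(K_1,\leq_{\mathbf{K}_1})$: $K_1$ is the class of torsion-free abelian $G$ with $|p_1^\omega G|,|p_2^\omega G|\le\aleph_0$, and $G_1\leq_{\mathbf{K}_1}G_2$ iff $G_1\leq_pG_2$, $p_1^\omega G_1=p_1^\omega G_2$, and either $G_1=p_1^\omega G_1$ or $p_2^\omega G_1=p_2^\omega G_2$. For a class $\mathbf{K}=(K,\leq_\mathbf{K})$: a $\mathbf{K}$-embedding $f:M\to N$ is an isomorphism onto $f[M]$ with $f[M]\leq_\mathbf{K}N$. Write $(b_1,A,N_1)E_{at}(b_2,A,N_2)$ if there are $N\in K$ and $\mathbf{K}$-embeddings $f_i:N_i\to N$ fixing $A$ pointwise with $f_1(b_1)=f_2(b_2)$;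 $E$ is the transitive closure of $E_{at}$, and the Galois type $\mathbf{gtp}_\mathbf{K}(b/A;N)$ is the $E$-class of $(b,A,N)$ (for $N\in K$, $A\subseteq N$, $b\in N$). -}

module Defs where

open import Level using (0ℓ) renaming (suc to lsuc)
open import Data.Nat using (ℕ; zero; suc; _^_)
open import Data.Product using (Σ; ∃; _×_; _,_)
open import Data.Sum using (_⊎_)
open import Relation.Binary.PropositionalEquality using (_≡_; _≢_)
open import Relation.Binary.Bundles using (Setoid)
open import Relation.Binary.Construct.Closure.Transitive using (TransClosure)
open import Algebra.Bundles using (AbelianGroup; Group)
import Algebra.Morphism.Structures as MS

Grp : Set₁
Grp = AbelianGroup 0ℓ 0ℓ

module _ (G : Grp) where
  open AbelianGroup G

  mul : ℕ → Carrier → Carrier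
  mul zero    x = ε
  mul (suc n) x = x ∙ mul n x

  TorsionFree : Set
  TorsionFree = ∀ (n : ℕ) (x : Carrier) → n ≢ 0 → mul n x ≈ ε → x ≈ ε

  InPω : ℕ → Carrier → Set
  InPω p x = ∀ (n : ℕ) → ∃ λ (y : Carrier) → mul (p ^ n) y ≈ x

  -- |p^ω G| ≤ ℵ₀ : an injection of p^ω G (as a set, i.e. modulo ≈) into ℕ
  CountablePω : ℕ → Set
  CountablePω p = ∃ λ (c : Σ Carrier (InPω p) → ℕ) →
    ∀ (u v : Σ Carrier (InPω p)) →
      (c u ≡ c v → Σ.proj₁ u ≈ Σ.proj₁ v) × (Σ.proj₁ u ≈ Σ.proj₁ v → c u ≡ c v)

record Mono (M N : Grp) : Set where
  open AbelianGroup M using () renaming (Carrier to CM)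
  open AbelianGroup N using () renaming (Carrier to CN)
  field
    fun  : CM → CN
    isMono : MS.GroupMorphisms.IsGroupMonomorphism
               (Group.rawGroup (AbelianGroup.group M))
               (Group.rawGroup (AbelianGroup.group N)) fun
open Mono public

Pure : (M N : Grp) → Mono M N → Set
Pure M N f = ∀ (n : ℕ) (g : AbelianGroup.Carrier M) (h : AbelianGroup.Carrier N) →
  AbelianGroup._≈_ N (mul N n h) (fun f g) →
  ∃ λ (g' : AbelianGroup.Carrier M) → AbelianGroup._≈_ M (mul M n g') g

SamePω : ℕ → (M N : Grp) → Mono M N → Set
SamePω p M N f =
  (∀ (g : AbelianGroup.Carrier M) → InPω M p g → InPω N p (fun f g)) ×
  (∀ (h : AbelianGroup.Carrier N) → InPω N p h →
     ∃ λ (g : AbelianGroup.Carrier M) → InPω M p g × AbelianGroup._≈_ N (fun f g) h)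

PωInside : ℕ → (M N : Grp) → Mono M N → Set
PωInside p M N f = ∀ (h : AbelianGroup.Carrier N) → InPω N p h →
  ∃ λ (g : AbelianGroup.Carrier M) → AbelianGroup._≈_ N (fun f g) h

-- An abstract class (K, ≤_K); ≤_K is given on embeddings, i.e. f[M] ≤_K N.
record AEClass : Set₂ where
  field
    InK : Grp → Set
    LeK : (M N : Grp) → Mono M N → Set
open AEClass public

KTF : AEClass
KTF = record { InK = TorsionFree ; LeK = Pure }

K1 : ℕ → ℕ → AEClass
K1 p₁ p₂ = record
  { InK = λ G → TorsionFree G × CountablePω G p₁ × CountablePω G p₂
  ; LeK = λ M N f → Pure M N f × SamePω p₁ M N f ×
            ((∀ (g : AbelianGroup.Carrier M) → InPω M p₁ g) ⊎ SamePω p₂ M N f)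
  }

-- Triples (b, A, N) with N ∈ K, A ⊆ N (A a set, given as a setoid with an
-- injective inclusion into the carrier of N), b ∈ N.
record Triple (K : AEClass) (A : Setoid 0ℓ 0ℓ) : Set₁ where
  open Setoid A using () renaming (Carrier to CA; _≈_ to _≈A_)
  field
    N     : Grp
    N∈K   : InK K N
    incl  : CA → AbelianGroup.Carrier N
    incl-cong : ∀ {x y} → x ≈A y → AbelianGroup._≈_ N (incl x) (incl y)
    incl-inj  : ∀ {x y} → AbelianGroup._≈_ N (incl x) (incl y) → x ≈A y
    elt   : AbelianGroup.Carrier N

Eat : (K : AEClass) (A : Setoid 0ℓ 0ℓ) → Triple K A → Triple K A → Set₁
Eat K A t₁ t₂ = Σ Grp λ N → InK K N × Σ (Mono (Triple.N t₁) N) λ f₁ → Σ (Mono (Triple.N t₂) N) λ f₂ →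
  LeK K (Triple.N t₁) N f₁ × LeK K (Triple.N t₂) N f₂ ×
  (∀ (a : Setoid.Carrier A) →
     AbelianGroup._≈_ N (fun f₁ (Triple.incl t₁ a)) (fun f₂ (Triple.incl t₂ a))) ×
  AbelianGroup._≈_ N (fun f₁ (Triple.elt t₁)) (fun f₂ (Triple.elt t₂))

SameGtp : (K : AEClass) (A : Setoid 0ℓ 0ℓ) → Triple K A → Triple K A → Set₁
SameGtp K A = TransClosure (Eat K A)

triple : (K : AEClass) (G H : Grp) → InK K H → (ι : Mono G H) → AbelianGroup.Carrier H →
         Triple K (AbelianGroup.setoid G)
triple K G H H∈K ι b = record
  { N = H ; N∈K = H∈K ; incl = fun ι
  ; incl-cong = MS.GroupMorphisms.IsGroupMonomorphism.⟦⟧-cong (isMono ι)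
  ; incl-inj = MS.GroupMorphisms.IsGroupMonomorphism.injective (isMono ι)
  ; elt = b }

-- Over G, the K_TF-Galois type of a in H is determined by which elements w(a) of ⟨G, a⟩ are
-- divisible by which n, and which of them coincide: pure embeddings preserve and reflect both.
-- When a₁ and a₂ agree on these data, the pure closure K = {h ∈ H₁ | n h ∈ ⟨G, a₁⟩ for some n ≠ 0}
-- embeds purely into H₂ over G by sending h with n h = w(a₁) to the n-th root of w(a₂), which
-- exists and is unique. Since p₁^ω H_i = p₁^ω G and p₂^ω H_i ⊆ G, a pure subgroup of H_i containing
-- G has the same p₁^ω and p₂^ω, so both K ⊆ H₁ and K → H₂ are K₁-embeddings and
-- (a₁, G, H₁) E_at (a₁, G, K) E_at (a₂, G, H₂). Conversely, every K₁-embedding is pure.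

{-# OPTIONS --safe #-}
module Submission where

open import Defs
open import Data.Nat using (ℕ)
open import Data.Nat.Primality using (Prime)
open import Data.Product using (_×_; proj₁)
open import Relation.Binary.PropositionalEquality using (_≢_)
open import Algebra.Bundles using (AbelianGroup)

open import Level using (0ℓ)
open import Data.Nat using (zero; suc; _*_; _^_)
open import Data.Nat.Properties using (*-comm; m*n≡0⇒m≡0∨n≡0)
open import Data.Maybe using (Maybe; just; nothing; maybe′)
open import Data.Product using (Σ; ∃; _,_; proj₂)
open import Data.Sum using (inj₂; [_,_]′)
open import Function using (_∘_; _⇔_; mk⇔; Equivalence)
import Function.Properties.Equivalence as ⇔
import Relation.Binary.PropositionalEquality as ≡
open import Relation.Binary.Bundles using (Setoid)
open import Relation.Binary.Construct.Closure.Transitive using ([_]; _∷_)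
open import Algebra.Bundles using (RawGroup)
open import Algebra.Morphism.Structures using (module GroupMorphisms)
import Algebra.Morphism.GroupMonomorphism as GroupMonomorphism
import Algebra.Morphism.Construct.Identity as Identity
import Algebra.Properties.Group as GroupProperties
import Algebra.Properties.CommutativeMonoid.Mult as Mult

open AbelianGroup using (Carrier)

*-≢0 : ∀ {m n} → m ≢ 0 → n ≢ 0 → m * n ≢ 0
*-≢0 {m} m≢0 n≢0 m*n≡0 = [ m≢0 , n≢0 ]′ (m*n≡0⇒m≡0∨n≡0 m m*n≡0)

module Multiples (H : Grp) where
  open AbelianGroup H
  open Mult commutativeMonoid using (×-congʳ; ×-distrib-+; ×-assocˡ) renaming (_×_ to _·_)
  open GroupProperties group using (inverseʳ-unique; x∙y⁻¹≈ε⇒x≈y)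
  open import Relation.Binary.Reasoning.Setoid setoid

  private
    mul≡· : ∀ n x → mul H n x ≡.≡ n · x
    mul≡· zero    x = ≡.refl
    mul≡· (suc n) x = ≡.cong (x ∙_) (mul≡· n x)

  mul-cong : ∀ n {x y} → x ≈ y → mul H n x ≈ mul H n y
  mul-cong n {x} {y} x≈y rewrite mul≡· n x | mul≡· n y = ×-congʳ n x≈y

  mul-∙ : ∀ n x y → mul H n (x ∙ y) ≈ mul H n x ∙ mul H n y
  mul-∙ n x y rewrite mul≡· n (x ∙ y) | mul≡· n x | mul≡· n y = ×-distrib-+ x y n

  mul-* : ∀ m n x → mul H (m * n) x ≈ mul H m (mul H n x)
  mul-* m n x rewrite mul≡· (m * n) x | mul≡· n x | mul≡· m (n · x) = sym (×-assocˡ x m n)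

  mul-comm : ∀ m n x → mul H m (mul H n x) ≈ mul H n (mul H m x)
  mul-comm m n x = begin
    mul H m (mul H n x) ≈⟨ mul-* m n x ⟨
    mul H (m * n) x     ≡⟨ ≡.cong (λ k → mul H k x) (*-comm m n) ⟩
    mul H (n * m) x     ≈⟨ mul-* n m x ⟩
    mul H n (mul H m x) ∎

  mul-ε : ∀ n → mul H n ε ≈ ε
  mul-ε zero    = refl
  mul-ε (suc n) = trans (identityˡ _) (mul-ε n)

  mul-⁻¹ : ∀ n x → mul H n (x ⁻¹) ≈ mul H n x ⁻¹
  mul-⁻¹ n x = inverseʳ-unique (mul H n x) (mul H n (x ⁻¹))
    (trans (sym (mul-∙ n x (x ⁻¹))) (trans (mul-cong n (inverseʳ x)) (mul-ε n)))

  mul-*-∙ : ∀ n l {u v a b} → mul H n u ≈ a → mul H l v ≈ b →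
            mul H (n * l) (u ∙ v) ≈ mul H l a ∙ mul H n b
  mul-*-∙ n l {u} {v} {a} {b} nu≈a lv≈b = begin
    mul H (n * l) (u ∙ v)                     ≈⟨ mul-∙ (n * l) u v ⟩
    mul H (n * l) u ∙ mul H (n * l) v         ≈⟨ ∙-cong (trans (mul-* n l u) (mul-comm n l u)) (mul-* n l v) ⟩
    mul H l (mul H n u) ∙ mul H n (mul H l v) ≈⟨ ∙-cong (mul-cong l nu≈a) (mul-cong n lv≈b) ⟩
    mul H l a ∙ mul H n b                     ∎

  module _ (torsionFree : TorsionFree H) where

    mul-cancel : ∀ n {x y} → n ≢ 0 → mul H n x ≈ mul H n y → x ≈ y
    mul-cancel n {x} {y} n≢0 nx≈ny = x∙y⁻¹≈ε⇒x≈y x y (torsionFree n (x ∙ y ⁻¹) n≢0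
      (trans (mul-∙ n x (y ⁻¹)) (trans (∙-cong nx≈ny (mul-⁻¹ n y)) (inverseʳ _))))

    root-unique : ∀ {n x y a} → n ≢ 0 → mul H n x ≈ a → mul H n y ≈ a → x ≈ y
    root-unique {n} n≢0 nx≈a ny≈a = mul-cancel n n≢0 (trans nx≈a (sym ny≈a))

    ≈⇔cross-mul : ∀ {n l u v a b} → n ≢ 0 → l ≢ 0 → mul H n u ≈ a → mul H l v ≈ b →
                  u ≈ v ⇔ mul H l a ≈ mul H n b
    ≈⇔cross-mul {n} {l} {u} {v} {a} {b} n≢0 l≢0 nu≈a lv≈b = mk⇔ to from
      where
      to : u ≈ v → mul H l a ≈ mul H n b
      to u≈v = begin
        mul H l a           ≈⟨ mul-cong l nu≈a ⟨
        mul H l (mul H n u) ≈⟨ mul-comm l n u ⟩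
        mul H n (mul H l u) ≈⟨ mul-cong n (mul-cong l u≈v) ⟩
        mul H n (mul H l v) ≈⟨ mul-cong n lv≈b ⟩
        mul H n b           ∎
      from : mul H l a ≈ mul H n b → u ≈ v
      from la≈nb = mul-cancel (n * l) (*-≢0 n≢0 l≢0) (begin
        mul H (n * l) u     ≈⟨ trans (mul-* n l u) (mul-comm n l u) ⟩
        mul H l (mul H n u) ≈⟨ mul-cong l nu≈a ⟩
        mul H l a           ≈⟨ la≈nb ⟩
        mul H n b           ≈⟨ mul-cong n lv≈b ⟨
        mul H n (mul H l v) ≈⟨ mul-* n l v ⟨
        mul H (n * l) v     ∎)

module _ (M N : RawGroup 0ℓ 0ℓ) where
  open GroupMorphisms M N using (IsGroupMonomorphism)
  private
    module M = RawGroup M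
    module N = RawGroup N

  mkIsGroupMonomorphism : (f : M.Carrier → N.Carrier) →
    (∀ {x y} → x M.≈ y → f x N.≈ f y) → (∀ x y → f (x M.∙ y) N.≈ f x N.∙ f y) →
    f M.ε N.≈ N.ε → (∀ x → f (x M.⁻¹) N.≈ f x N.⁻¹) →
    (∀ {x y} → f x N.≈ f y → x M.≈ y) → IsGroupMonomorphism f
  mkIsGroupMonomorphism f cong homo ε-homo ⁻¹-homo injective = record
    { isGroupHomomorphism = record
      { isMonoidHomomorphism = record
        { isMagmaHomomorphism = record
          { isRelHomomorphism = record { cong = cong }
          ; homo = homo }
        ; ε-homo = ε-homo }
      ; ⁻¹-homo = ⁻¹-homo }
    ; injective = injective }

idMono : (H : Grp) → Mono H H
idMono H = record
  { fun = λ x → x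
  ; isMono = Identity.isGroupMonomorphism (AbelianGroup.rawGroup H) (AbelianGroup.refl H) }

Divides : (H : Grp) → ℕ → Carrier H → Set
Divides H n x = ∃ λ y → AbelianGroup._≈_ H (mul H n y) x

module _ (H : Grp) where
  open AbelianGroup H

  Divides-resp : ∀ n {x y} → x ≈ y → Divides H n x ⇔ Divides H n y
  Divides-resp n x≈y = mk⇔ (λ (z , nz≈x) → z , trans nz≈x x≈y)
                            (λ (z , nz≈y) → z , trans nz≈y (sym x≈y))

  ≈-resp⇔ : ∀ {x x′ y y′} → x ≈ x′ → y ≈ y′ → x ≈ y ⇔ x′ ≈ y′
  ≈-resp⇔ x≈x′ y≈y′ = mk⇔ (λ x≈y → trans (sym x≈x′) (trans x≈y y≈y′))
                           (λ x′≈y′ → trans x≈x′ (trans x′≈y′ (sym y≈y′)))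

  InPω-resp : ∀ p {x y} → x ≈ y → InPω H p x → InPω H p y
  InPω-resp p x≈y x∈pω k = Equivalence.to (Divides-resp (p ^ k) x≈y) (x∈pω k)

module _ {M N : Grp} (f : Mono M N) where
  open AbelianGroup N hiding (Carrier)
  open GroupMorphisms.IsGroupMonomorphism (isMono f)

  mul-homo : ∀ n x → fun f (mul M n x) ≈ mul N n (fun f x)
  mul-homo zero    x = ε-homo
  mul-homo (suc n) x = trans (∙-homo x _) (∙-congˡ (mul-homo n x))

  Divides-homo : ∀ n {x} → Divides M n x → Divides N n (fun f x)
  Divides-homo n (y , ny≈x) = fun f y , trans (sym (mul-homo n y)) (⟦⟧-cong ny≈x)

  InPω-homo : ∀ p {x} → InPω M p x → InPω N p (fun f x)
  InPω-homo p x∈pω k = Divides-homo (p ^ k) (x∈pω k)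

  ≈⇔homo-≈ : ∀ {x y} → AbelianGroup._≈_ M x y ⇔ fun f x ≈ fun f y
  ≈⇔homo-≈ = mk⇔ ⟦⟧-cong injective

  torsionFree-reflect : TorsionFree N → TorsionFree M
  torsionFree-reflect torsionFree n x n≢0 nx≈ε = injective (trans fx≈ε (sym ε-homo))
    where
    fx≈ε : fun f x ≈ ε
    fx≈ε = torsionFree n (fun f x) n≢0 (trans (sym (mul-homo n x)) (trans (⟦⟧-cong nx≈ε) ε-homo))

  countablePω-reflect : ∀ {p} → CountablePω N p → CountablePω M p
  countablePω-reflect (code , code-spec) = code ∘ image , λ u v →
    let (code≡⇒≈ , ≈⇒code≡) = code-spec (image u) (image v) in injective ∘ code≡⇒≈ , ≈⇒code≡ ∘ ⟦⟧-cong
    where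
    image : Σ (Carrier M) (InPω M _) → Σ (Carrier N) (InPω N _)
    image (x , x∈pω) = fun f x , InPω-homo _ x∈pω

  module _ (pure : Pure M N f) where

    pure⇒Divides⇔ : ∀ n {x} → Divides M n x ⇔ Divides N n (fun f x)
    pure⇒Divides⇔ n {x} = mk⇔ (Divides-homo n) (λ (y , ny≈fx) → pure n x y ny≈fx)

    pure⇒InPω-reflect : ∀ p {x} → InPω N p (fun f x) → InPω M p x
    pure⇒InPω-reflect p fx∈pω k = Equivalence.from (pure⇒Divides⇔ (p ^ k)) (fx∈pω k)

    pure⇒SamePω : ∀ {p} → PωInside p M N f → SamePω p M N f
    pure⇒SamePω {p} pω⊆image = (λ _ → InPω-homo p) , λ h h∈pω →
      let (x , fx≈h) = pω⊆image h h∈pω in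
      x , pure⇒InPω-reflect p (InPω-resp N p (sym fx≈h) h∈pω) , fx≈h

module _ {p₁ p₂ : ℕ} where

  K1-reflect : ∀ {M N} → Mono M N → InK (K1 p₁ p₂) N → InK (K1 p₁ p₂) M
  K1-reflect f (torsionFree , countable₁ , countable₂) =
    torsionFree-reflect f torsionFree ,
    countablePω-reflect f countable₁ , countablePω-reflect f countable₂

  ≤K1-refl : ∀ {H} → LeK (K1 p₁ p₂) H H (idMono H)
  ≤K1-refl {H} =
    pure , pure⇒SamePω (idMono H) pure everything , inj₂ (pure⇒SamePω (idMono H) pure everything)
    where
    pure : Pure H H (idMono H)
    pure _ _ h nh≈g = h , nh≈g
    everything : ∀ {p} → PωInside p H H (idMono H)
    everything h _ = h , AbelianGroup.refl H

  pure-over-≤K1 : ∀ {G K N} (ι : Mono G N) (f : Mono K N) (κ : Carrier G → Carrier K) →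
    (∀ g → AbelianGroup._≈_ N (fun f (κ g)) (fun ι g)) → Pure K N f →
    LeK (K1 p₁ p₂) G N ι → PωInside p₂ G N ι → LeK (K1 p₁ p₂) K N f
  pure-over-≤K1 {G} {K} {N} ι f κ fκ≈ι pure (_ , (_ , samePω₁) , _) pω₂⊆ι =
    pure , pure⇒SamePω f pure (through pω₁⊆ι) , inj₂ (pure⇒SamePω f pure (through pω₂⊆ι))
    where
    pω₁⊆ι : PωInside p₁ G N ι
    pω₁⊆ι h h∈pω = let (g , _ , ιg≈h) = samePω₁ h h∈pω in g , ιg≈h
    through : ∀ {p} → PωInside p G N ι → PωInside p K N f
    through pω⊆ι h h∈pω = let (g , ιg≈h) = pω⊆ι h h∈pω in κ g , AbelianGroup.trans N (fκ≈ι g) ιg≈h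

infixl 7 _:∙_
infixr 8 _:×_

data Term (X : Set) : Set where
  var  : X → Term X
  :ε   : Term X
  _:∙_ : Term X → Term X → Term X
  _:⁻¹ : Term X → Term X
  _:×_ : ℕ → Term X → Term X

module _ (H : Grp) {X : Set} where
  open AbelianGroup H hiding (Carrier)

  eval : Term X → (X → Carrier H) → Carrier H
  eval (var x)  ρ = ρ x
  eval :ε       ρ = ε
  eval (w :∙ v) ρ = eval w ρ ∙ eval v ρ
  eval (w :⁻¹)  ρ = eval w ρ ⁻¹
  eval (n :× w) ρ = mul H n (eval w ρ)

  eval-cong : ∀ {ρ σ} → (∀ x → ρ x ≈ σ x) → ∀ w → eval w ρ ≈ eval w σ
  eval-cong ρ≈σ (var x)  = ρ≈σ x
  eval-cong ρ≈σ :ε       = refl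
  eval-cong ρ≈σ (w :∙ v) = ∙-cong (eval-cong ρ≈σ w) (eval-cong ρ≈σ v)
  eval-cong ρ≈σ (w :⁻¹)  = ⁻¹-cong (eval-cong ρ≈σ w)
  eval-cong ρ≈σ (n :× w) = Multiples.mul-cong H n (eval-cong ρ≈σ w)

module _ {M N : Grp} (f : Mono M N) {X : Set} where
  open AbelianGroup N hiding (Carrier)
  open GroupMorphisms.IsGroupMonomorphism (isMono f)

  eval-homo : ∀ {ρ : X → Carrier M} w → fun f (eval M w ρ) ≈ eval N w (fun f ∘ ρ)
  eval-homo (var x)  = refl
  eval-homo :ε       = ε-homo
  eval-homo (w :∙ v) = trans (∙-homo _ _) (∙-cong (eval-homo w) (eval-homo v))
  eval-homo (w :⁻¹)  = trans (⁻¹-homo _) (⁻¹-cong (eval-homo w))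
  eval-homo (n :× w) = trans (mul-homo f n _) (Multiples.mul-cong N n (eval-homo w))

eval-agree : ∀ {X M₁ M₂ N} (f₁ : Mono M₁ N) (f₂ : Mono M₂ N)
  {ρ₁ : X → Carrier M₁} {ρ₂ : X → Carrier M₂} →
  (∀ x → AbelianGroup._≈_ N (fun f₁ (ρ₁ x)) (fun f₂ (ρ₂ x))) →
  ∀ w → AbelianGroup._≈_ N (fun f₁ (eval M₁ w ρ₁)) (fun f₂ (eval M₂ w ρ₂))
eval-agree {N = N} f₁ f₂ agree w =
  trans (eval-homo f₁ w) (trans (eval-cong N agree w) (sym (eval-homo f₂ w)))
  where open AbelianGroup N

module Subgroup (H : Grp) (P : Carrier H → Set) (ε∈P : P (AbelianGroup.ε H))
  (∙∈P : ∀ {x y} → P x → P y → P (AbelianGroup._∙_ H x y))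
  (⁻¹∈P : ∀ {x} → P x → P (AbelianGroup._⁻¹ H x)) where
  open AbelianGroup H hiding (Carrier)

  private
    raw : RawGroup 0ℓ 0ℓ
    raw = record
      { Carrier = Σ (Carrier H) P
      ; _≈_     = λ u v → proj₁ u ≈ proj₁ v
      ; _∙_     = λ (x , x∈P) (y , y∈P) → x ∙ y , ∙∈P x∈P y∈P
      ; ε       = ε , ε∈P
      ; _⁻¹     = λ (x , x∈P) → x ⁻¹ , ⁻¹∈P x∈P
      }

    proj₁-isMono : GroupMorphisms.IsGroupMonomorphism raw rawGroup proj₁
    proj₁-isMono =
      mkIsGroupMonomorphism raw rawGroup proj₁ (λ u≈v → u≈v) (λ _ _ → refl) refl (λ _ → refl) (λ u≈v → u≈v)

  subgroup : Grp
  subgroup = record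
    { RawGroup raw
    ; isAbelianGroup = GroupMonomorphism.isAbelianGroup proj₁-isMono isAbelianGroup
    }

  inclusion : Mono subgroup H
  inclusion = record { fun = proj₁ ; isMono = proj₁-isMono }

  restrict : ∀ {M} (f : Mono M H) → (∀ x → P (fun f x)) → Mono M subgroup
  restrict {M} f f∈P = record
    { fun = λ x → fun f x , f∈P x
    ; isMono =
        mkIsGroupMonomorphism (AbelianGroup.rawGroup M) raw _ ⟦⟧-cong ∙-homo ε-homo ⁻¹-homo injective
    }
    where open GroupMorphisms.IsGroupMonomorphism (isMono f)

module PureClosure (H : Grp) {X : Set} (ρ : X → Carrier H) where
  open AbelianGroup H hiding (Carrier)
  open Multiples H

  ⟦_⟧ : Term X → Carrier H
  ⟦ w ⟧ = eval H w ρ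

  record InClosure (h : Carrier H) : Set where
    constructor witness
    field
      index   : ℕ
      index≢0 : index ≢ 0
      term    : Term X
      root    : mul H index h ≈ ⟦ term ⟧

  ρ∈closure : ∀ x → InClosure (ρ x)
  ρ∈closure x = witness 1 (λ ()) (var x) (identityʳ (ρ x))

  private
    ε∈closure : InClosure ε
    ε∈closure = witness 1 (λ ()) :ε (identityʳ ε)

    ∙∈closure : ∀ {x y} → InClosure x → InClosure y → InClosure (x ∙ y)
    ∙∈closure (witness n n≢0 w nx≈w) (witness l l≢0 v ly≈v) =
      witness (n * l) (*-≢0 n≢0 l≢0) (l :× w :∙ n :× v) (mul-*-∙ n l nx≈w ly≈v)

    ⁻¹∈closure : ∀ {x} → InClosure x → InClosure (x ⁻¹)
    ⁻¹∈closure (witness n n≢0 w nx≈w) = witness n n≢0 (w :⁻¹) (trans (mul-⁻¹ n _) (⁻¹-cong nx≈w))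

  open Subgroup H InClosure ε∈closure ∙∈closure ⁻¹∈closure public renaming (subgroup to closure)

  generator : X → Carrier closure
  generator x = ρ x , ρ∈closure x

  index : Carrier closure → ℕ
  index = InClosure.index ∘ proj₂

  term : Carrier closure → Term X
  term = InClosure.term ∘ proj₂

  inclusion-pure : Pure closure H inclusion
  inclusion-pure zero    u _ ε≈u = u , ε≈u
  inclusion-pure (suc m) (h , witness n n≢0 w nh≈w) k mk≈h =
    (k , witness (n * suc m) (*-≢0 n≢0 (λ ())) w nmk≈w) , trans (mul-homo inclusion (suc m) _) mk≈h
    where
    nmk≈w : mul H (n * suc m) k ≈ ⟦ w ⟧
    nmk≈w = trans (mul-* n (suc m) k) (trans (mul-cong n mk≈h) nh≈w)

module ClosureEmbedding {X : Set} (H₁ H₂ : Grp)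
  (torsionFree₁ : TorsionFree H₁) (torsionFree₂ : TorsionFree H₂)
  (ρ₁ : X → Carrier H₁) (ρ₂ : X → Carrier H₂)
  (Divides⇔ : ∀ n w → Divides H₁ n (eval H₁ w ρ₁) ⇔ Divides H₂ n (eval H₂ w ρ₂))
  (≈⇔ : ∀ w v → AbelianGroup._≈_ H₁ (eval H₁ w ρ₁) (eval H₁ v ρ₁) ⇔
                AbelianGroup._≈_ H₂ (eval H₂ w ρ₂) (eval H₂ v ρ₂)) where
  open PureClosure H₁ ρ₁ public
  open AbelianGroup H₂ hiding (Carrier)
  open Multiples H₂
  private
    module H₁ = AbelianGroup H₁
    module M₁ = Multiples H₁
    module Closure = AbelianGroup closure

  ⟦_⟧₂ : Term X → Carrier H₂
  ⟦ w ⟧₂ = eval H₂ w ρ₂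

  private
    root₂ : ∀ u → Divides H₂ (index u) ⟦ term u ⟧₂
    root₂ (h , witness n _ w nh≈w) = Equivalence.to (Divides⇔ n w) (h , nh≈w)

  embed : Carrier closure → Carrier H₂
  embed = proj₁ ∘ root₂

  embed-root : ∀ u → mul H₂ (index u) (embed u) ≈ ⟦ term u ⟧₂
  embed-root = proj₂ ∘ root₂

  embed-≈⇔ : ∀ u v → proj₁ u H₁.≈ proj₁ v ⇔ embed u ≈ embed v
  embed-≈⇔ u@(_ , witness n n≢0 w nh≈w) v@(_ , witness l l≢0 w′ lk≈w′) =
    ⇔.trans (M₁.≈⇔cross-mul torsionFree₁ n≢0 l≢0 nh≈w lk≈w′) (⇔.trans (≈⇔ (l :× w) (n :× w′))
      (⇔.sym (≈⇔cross-mul torsionFree₂ n≢0 l≢0 (embed-root u) (embed-root v))))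

  embed-∙ : ∀ u v → embed (u Closure.∙ v) ≈ embed u ∙ embed v
  embed-∙ u@(_ , witness n n≢0 _ _) v@(_ , witness l l≢0 _ _) =
    root-unique torsionFree₂ (*-≢0 n≢0 l≢0) (embed-root (u Closure.∙ v))
      (mul-*-∙ n l (embed-root u) (embed-root v))

  embed-⁻¹ : ∀ u → embed (u Closure.⁻¹) ≈ embed u ⁻¹
  embed-⁻¹ u@(_ , witness n n≢0 _ _) =
    root-unique torsionFree₂ n≢0 (embed-root (u Closure.⁻¹))
      (trans (mul-⁻¹ n (embed u)) (⁻¹-cong (embed-root u)))

  embed-generator : ∀ x → embed (generator x) ≈ ρ₂ x
  embed-generator x = trans (sym (identityʳ _)) (embed-root (generator x))

  embed-ε : embed Closure.ε ≈ ε
  embed-ε = trans (sym (identityʳ _)) (embed-root Closure.ε)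

  embedding : Mono closure H₂
  embedding = record
    { fun = embed
    ; isMono = mkIsGroupMonomorphism Closure.rawGroup rawGroup embed
        (λ {u} {v} → Equivalence.to (embed-≈⇔ u v)) embed-∙ embed-ε embed-⁻¹
        (λ {u} {v} → Equivalence.from (embed-≈⇔ u v))
    }

  embed-Divides-reflect : ∀ m u → Divides H₂ m (embed u) → Divides H₁ m (proj₁ u)
  embed-Divides-reflect m u@(h , witness n n≢0 w nh≈w) (k , mk≈eu) =
    let (h′ , nmh′≈w) = Equivalence.from (Divides⇔ (n * m) w) (k , nmk≈w) in
    h′ , M₁.mul-cancel torsionFree₁ n n≢0
           (H₁.trans (H₁.sym (M₁.mul-* n m h′)) (H₁.trans nmh′≈w (H₁.sym nh≈w)))
    where
    nmk≈w : mul H₂ (n * m) k ≈ ⟦ w ⟧₂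
    nmk≈w = trans (mul-* n m k) (trans (mul-cong n mk≈eu) (embed-root u))

  embed-pure : Pure closure H₂ embedding
  embed-pure m u k mk≈eu =
    let (h , mh≈u) = embed-Divides-reflect m u (k , mk≈eu) in inclusion-pure m u h mh≈u

module _ {K : AEClass} {A : Setoid 0ℓ 0ℓ} where

  valuation : (t : Triple K A) → Maybe (Setoid.Carrier A) → Carrier (Triple.N t)
  valuation t = maybe′ (Triple.incl t) (Triple.elt t)

  DividesIn : Triple K A → ℕ → Term (Maybe (Setoid.Carrier A)) → Set
  DividesIn t n w = Divides (Triple.N t) n (eval (Triple.N t) w (valuation t))

  EqualIn : Triple K A → Term (Maybe (Setoid.Carrier A)) → Term (Maybe (Setoid.Carrier A)) → Set
  EqualIn t w v =
    AbelianGroup._≈_ (Triple.N t) (eval (Triple.N t) w (valuation t)) (eval (Triple.N t) v (valuation t))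

  sameGtp-invariant : (Φ : Triple K A → Set) → (∀ t₁ t₂ → Eat K A t₁ t₂ → Φ t₁ ⇔ Φ t₂) →
                      ∀ {t₁ t₂} → SameGtp K A t₁ t₂ → Φ t₁ ⇔ Φ t₂
  sameGtp-invariant Φ eat⇒⇔ {t₁} {t₂} [ t₁∼t₂ ] = eat⇒⇔ t₁ t₂ t₁∼t₂
  sameGtp-invariant Φ eat⇒⇔ {t₁} (_∷_ {y = t} t₁∼t t∼⁺t₂) =
    ⇔.trans (eat⇒⇔ t₁ t t₁∼t) (sameGtp-invariant Φ eat⇒⇔ t∼⁺t₂)

  eat-eval-agree : ∀ {t₁ t₂ : Triple K A} {N} (f₁ : Mono (Triple.N t₁) N) (f₂ : Mono (Triple.N t₂) N) →
    (∀ a → AbelianGroup._≈_ N (fun f₁ (Triple.incl t₁ a)) (fun f₂ (Triple.incl t₂ a))) →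
    AbelianGroup._≈_ N (fun f₁ (Triple.elt t₁)) (fun f₂ (Triple.elt t₂)) →
    ∀ w → AbelianGroup._≈_ N (fun f₁ (eval (Triple.N t₁) w (valuation t₁)))
                              (fun f₂ (eval (Triple.N t₂) w (valuation t₂)))
  eat-eval-agree f₁ f₂ agree agree-elt = eval-agree f₁ f₂ λ { (just a) → agree a ; nothing → agree-elt }

  sameGtp⇒EqualIn⇔ : ∀ {t₁ t₂} → SameGtp K A t₁ t₂ → ∀ w v → EqualIn t₁ w v ⇔ EqualIn t₂ w v
  sameGtp⇒EqualIn⇔ t₁∼⁺t₂ w v = sameGtp-invariant (λ t → EqualIn t w v) eat⇒EqualIn⇔ t₁∼⁺t₂
    where
    eat⇒EqualIn⇔ : ∀ t₁ t₂ → Eat K A t₁ t₂ → EqualIn t₁ w v ⇔ EqualIn t₂ w v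
    eat⇒EqualIn⇔ t₁ t₂ (N , _ , f₁ , f₂ , _ , _ , agree , agree-elt) =
      ⇔.trans (≈⇔homo-≈ f₁) (⇔.trans (≈-resp⇔ N (agreement w) (agreement v)) (⇔.sym (≈⇔homo-≈ f₂)))
      where
      agreement = eat-eval-agree {t₁ = t₁} {t₂} f₁ f₂ agree agree-elt

module _ {A : Setoid 0ℓ 0ℓ} where

  sameGtp⇒DividesIn⇔ : ∀ {t₁ t₂} → SameGtp KTF A t₁ t₂ → ∀ n w → DividesIn t₁ n w ⇔ DividesIn t₂ n w
  sameGtp⇒DividesIn⇔ t₁∼⁺t₂ n w = sameGtp-invariant (λ t → DividesIn t n w) eat⇒DividesIn⇔ t₁∼⁺t₂
    where
    eat⇒DividesIn⇔ : ∀ t₁ t₂ → Eat KTF A t₁ t₂ → DividesIn t₁ n w ⇔ DividesIn t₂ n w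
    eat⇒DividesIn⇔ t₁ t₂ (N , _ , f₁ , f₂ , pure₁ , pure₂ , agree , agree-elt) =
      ⇔.trans (pure⇒Divides⇔ f₁ pure₁ n)
        (⇔.trans (Divides-resp N n (eat-eval-agree {t₁ = t₁} {t₂} f₁ f₂ agree agree-elt w))
          (⇔.sym (pure⇒Divides⇔ f₂ pure₂ n)))

module _ {K K′ : AEClass} (InK⇒ : ∀ {N} → InK K N → InK K′ N)
  (LeK⇒ : ∀ {M N f} → LeK K M N f → LeK K′ M N f) {A : Setoid 0ℓ 0ℓ} where

  retype : Triple K A → Triple K′ A
  retype t = record { Triple t hiding (N∈K) ; N∈K = InK⇒ (Triple.N∈K t) }

  retype-Eat : ∀ {t₁ t₂} → Eat K A t₁ t₂ → Eat K′ A (retype t₁) (retype t₂)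
  retype-Eat (N , N∈K , f₁ , f₂ , f₁≤ , f₂≤ , agree) =
    N , InK⇒ N∈K , f₁ , f₂ , LeK⇒ f₁≤ , LeK⇒ f₂≤ , agree

  retype-SameGtp : ∀ {t₁ t₂} → SameGtp K A t₁ t₂ → SameGtp K′ A (retype t₁) (retype t₂)
  retype-SameGtp {t₁} {t₂} [ t₁∼t₂ ]     = [ retype-Eat {t₁} {t₂} t₁∼t₂ ]
  retype-SameGtp {t₁} (_∷_ {y = t} t₁∼t t∼⁺t₂) = retype-Eat {t₁} {t} t₁∼t ∷ retype-SameGtp t∼⁺t₂

sameGtp-KTF⇒sameGtp-K1 : ∀ {p₁ p₂ G H₁ H₂ H₁∈ H₂∈} (ι₁ : Mono G H₁) (ι₂ : Mono G H₂) →
  LeK (K1 p₁ p₂) G H₁ ι₁ → LeK (K1 p₁ p₂) G H₂ ι₂ → PωInside p₂ G H₁ ι₁ → PωInside p₂ G H₂ ι₂ → ∀ a₁ a₂ →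
  SameGtp KTF (AbelianGroup.setoid G)
    (triple KTF G H₁ (proj₁ H₁∈) ι₁ a₁) (triple KTF G H₂ (proj₁ H₂∈) ι₂ a₂) →
  SameGtp (K1 p₁ p₂) (AbelianGroup.setoid G)
    (triple (K1 p₁ p₂) G H₁ H₁∈ ι₁ a₁) (triple (K1 p₁ p₂) G H₂ H₂∈ ι₂ a₂)
sameGtp-KTF⇒sameGtp-K1 {p₁} {p₂} {G} {H₁} {H₂} {H₁∈} {H₂∈}
  ι₁ ι₂ G≤H₁ G≤H₂ pω₂⊆ι₁ pω₂⊆ι₂ a₁ a₂ sameKTF =
  _∷_ {y = middle} E₁ [ E₂ ]
  where
  open ClosureEmbedding H₁ H₂ (proj₁ H₁∈) (proj₁ H₂∈) (maybe′ (fun ι₁) a₁) (maybe′ (fun ι₂) a₂)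
    (sameGtp⇒DividesIn⇔ sameKTF) (sameGtp⇒EqualIn⇔ sameKTF)
  ι : Mono G closure
  ι = restrict ι₁ (ρ∈closure ∘ just)
  middle = triple (K1 p₁ p₂) G closure (K1-reflect inclusion H₁∈) ι (generator nothing)
  E₁ = H₁ , H₁∈ , idMono H₁ , inclusion , ≤K1-refl ,
       pure-over-≤K1 ι₁ inclusion (fun ι) (λ _ → AbelianGroup.refl H₁) inclusion-pure G≤H₁ pω₂⊆ι₁ ,
       (λ _ → AbelianGroup.refl H₁) , AbelianGroup.refl H₁
  E₂ = H₂ , H₂∈ , embedding , idMono H₂ ,
       pure-over-≤K1 ι₂ embedding (fun ι) (embed-generator ∘ just) embed-pure G≤H₂ pω₂⊆ι₂ , ≤K1-refl ,
       embed-generator ∘ just , embed-generator nothing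

proposition3p14 : (p₁ p₂ : ℕ) → Prime p₁ → Prime p₂ → p₁ ≢ p₂ →
    (G H₁ H₂ : Grp) →
    (G∈ : InK (K1 p₁ p₂) G) (H₁∈ : InK (K1 p₁ p₂) H₁) (H₂∈ : InK (K1 p₁ p₂) H₂) →
    (ι₁ : Mono G H₁) (ι₂ : Mono G H₂) →
    LeK (K1 p₁ p₂) G H₁ ι₁ → LeK (K1 p₁ p₂) G H₂ ι₂ →
    (a₁ : AbelianGroup.Carrier H₁) (a₂ : AbelianGroup.Carrier H₂) →
    PωInside p₂ G H₁ ι₁ → PωInside p₂ G H₂ ι₂ →
    (SameGtp KTF (AbelianGroup.setoid G)
       (triple KTF G H₁ (proj₁ H₁∈) ι₁ a₁) (triple KTF G H₂ (proj₁ H₂∈) ι₂ a₂) →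
     SameGtp (K1 p₁ p₂) (AbelianGroup.setoid G)
       (triple (K1 p₁ p₂) G H₁ H₁∈ ι₁ a₁) (triple (K1 p₁ p₂) G H₂ H₂∈ ι₂ a₂)) ×
    (SameGtp (K1 p₁ p₂) (AbelianGroup.setoid G)
       (triple (K1 p₁ p₂) G H₁ H₁∈ ι₁ a₁) (triple (K1 p₁ p₂) G H₂ H₂∈ ι₂ a₂) →
     SameGtp KTF (AbelianGroup.setoid G)
       (triple KTF G H₁ (proj₁ H₁∈) ι₁ a₁) (triple KTF G H₂ (proj₁ H₂∈) ι₂ a₂))
proposition3p14 _ _ _ _ _ _ _ _ _ _ _ ι₁ ι₂ G≤H₁ G≤H₂ a₁ a₂ pω₂⊆ι₁ pω₂⊆ι₂ =
  sameGtp-KTF⇒sameGtp-K1 ι₁ ι₂ G≤H₁ G≤H₂ pω₂⊆ι₁ pω₂⊆ι₂ a₁ a₂ , retype-SameGtp proj₁ proj₁
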